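{- For $\rho\in\mathbb N$ and $\tau\in\mathbb N^*$, $$|\mathcal F^\rho_\tau|=\frac{\tau}{4\rho+\tau}\binom{4\rho+\tau}{\rho}.$$
   Context: Let $\mathbb N=\{0,1,\dots\}$, $\mathbb N^*=\mathbb N\setminus\{0\}$ and $\mathcal F=\bigcup_{k\geq1}(\mathbb N^*)^k$ the set of finite nonempty words over $\mathbb N^*$; $|u|$ is the length of $u$; for $|w|\geq 2$ the parent $pa(w)$ is $w$ with its last letter removed. A forest is a nonempty finite $F\subseteq\mathcal F$ such that: (1) there is $t(F)\in\mathbb N$ with $\{u\in F:|u|=1\}=\{1,\dots,t(F)+1\}$; (2) if $u\in F$ and $|u|\geq 2$ then $pa(u)\in F$; (3) for each $u\in F$ there is $c_u(F)\in\mathbb N$ with $ui\in F$ iff $i\leq c_u(F)$; (4) $c_{t(F)+1}(F)=0$. $\mathbb F^\rho_\tau$ is the set of forests with $t(F)=\tau$ and $\rho+\tau+1$ elements. A well-labeled forest is a pair $(F,\ell)$ with $F$ a forest and $\ell:F\to\mathbb Z$ such that $\ell(u)=0$ if $|u|=1$, $\ell(u)=-1$ if $|u|=2$, and for every $u$ with $|u|\geq2$ and $c_u(F)\geq1$: $\ell(u)-1\leq\ell(u1)\leq\ell(u2)\leq\dots\leq\ell(u\,c_u(F))\leq\ell(u)+1$. $\mathcal F^\rho_\tau$ is the set of well-labeled forests $(F,\ell)$ with $F\in\mathbb F^\rho_\tau$. -}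

module Defs where

open import Data.Nat using (ℕ; zero; suc; _+_; _*_; _≤_; _<_)
open import Data.Nat.Combinatorics using (_C_)
open import Data.Integer as ℤ using (ℤ; +_; -[1+_])
open import Data.List using (List; []; _∷_; [_]; _++_; map; length; upTo)
open import Data.List.Relation.Unary.All using (All)
open import Data.List.Relation.Unary.Linked using (Linked)
open import Data.List.Relation.Unary.Unique.Propositional using (Unique)
open import Data.List.Membership.Propositional using (_∈_)
open import Data.Product using (Σ; ∃; _×_; proj₁; _,_)
open import Data.List using (List)
open import Function.Bundles using (_⇔_)
open import Relation.Binary.PropositionalEquality using (_≡_; _≢_)
open import Relation.Nullary using (¬_; yes; no)
import Data.List.Properties as LP
import Data.Nat.Properties as NP

-- Words over ℕ (elements of 𝓕 are the nonempty words with letters in ℕ*;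
-- these constraints are imposed in the definition of a forest below).
Word : Set
Word = List ℕ

-- Strict lexicographic order on words, used only to make the finite-set
-- representation canonical (a finite set = its strictly sorted list).
data _<w_ : Word → Word → Set where
  []<∷  : ∀ {y ys} → [] <w (y ∷ ys)
  here  : ∀ {x y xs ys} → x < y → (x ∷ xs) <w (y ∷ ys)
  there : ∀ {x xs ys} → xs <w ys → (x ∷ xs) <w (x ∷ ys)

-- A raw labelled finite set of words: the list of pairs (u , ℓ(u)).
-- Together with the 'sorted' condition below, this is exactly a finite
-- set F ⊆ words together with a function ℓ : F → ℤ.
LForest : Set
LForest = List (Word × ℤ)

dom : LForest → List Word
dom = map proj₁

_∈F_ : Word → LForest → Set
u ∈F L = u ∈ dom L

-- ℓ(u) (default value 0 is irrelevant: only used for u ∈ F)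
lab : LForest → Word → ℤ
lab [] u = + 0
lab ((v , z) ∷ L) u with LP.≡-dec NP._≟_ u v
... | yes _ = z
... | no  _ = lab L u

oneTo : ℕ → List ℕ
oneTo c = map suc (upTo c)

IsChildCount : LForest → Word → ℕ → Set
IsChildCount L u c = ∀ i → 1 ≤ i → ((u ++ [ i ]) ∈F L ⇔ (i ≤ c))

-- (F , ℓ) ∈ 𝓕^ρ_τ : a well-labeled forest with t(F) = τ and ρ + τ + 1 elements
record WellLabeledForest (ρ τ : ℕ) (L : LForest) : Set where
  field
    sorted   : Linked _<w_ (dom L)
    words    : All (λ u → (u ≢ []) × All (1 ≤_) u) (dom L)
    roots    : ∀ i → ([ i ] ∈F L) ⇔ ((1 ≤ i) × (i ≤ τ + 1))
    parent   : ∀ u i → (u ++ [ i ]) ∈F L → u ≢ [] → u ∈F L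
    children : ∀ u → u ∈F L → ∃ λ c → IsChildCount L u c
    lastRoot : ∀ i → 1 ≤ i → ¬ ((suc τ ∷ [ i ]) ∈F L)
    size     : length L ≡ ρ + τ + 1
    labRoot  : ∀ u → u ∈F L → length u ≡ 1 → lab L u ≡ + 0
    labTwo   : ∀ u → u ∈F L → length u ≡ 2 → lab L u ≡ -[1+ 0 ]
    labChild : ∀ u → u ∈F L → 2 ≤ length u → ∀ c → IsChildCount L u c → 1 ≤ c →
               Linked ℤ._≤_
                 ((lab L u ℤ.- + 1) ∷ (map (λ i → lab L (u ++ [ i ])) (oneTo c)
                                       ++ [ lab L u ℤ.+ + 1 ]))

-- E is a duplicate-free list of exactly the objects satisfying P,
-- so that length E is the cardinality of {x | P x}.
Enumerates : {A : Set} → (A → Set) → List A → Set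
Enumerates {A} P E = Unique E × (∀ x → (x ∈ E) ⇔ P x)

-- In a forest of 𝓕^ρ_τ the roots 1, …, τ + 1 are labelled 0, the last root is a leaf, the
-- children of the other roots are labelled -1, and the children of a deeper vertex labelled ℓ
-- carry labels ℓ - 1 ≤ … ≤ ℓ + 1. Such a vertex is thus determined by three lists of vertices
-- (its children labelled ℓ - 1, ℓ and ℓ + 1), so 𝓕^ρ_τ is in bijection with the sequences of
-- τ lists of such ternary nodes having ρ nodes in total. Splitting off the first list, which is
-- either empty or starts with a node whose three lists replace it, gives the recurrence
-- N(r+1, t+1) = N(r+1, t) + N(r, t+4), and (4r + t) N(r, t) = t C(4r + t, r) follows by
-- induction from Pascal's rule and the absorption identity (k+1) C(n, k+1) + k C(n, k) = n C(n, k).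

module Submission where

open import Defs
open import Data.Bool using (if_then_else_)
open import Data.Empty using (⊥; ⊥-elim)
open import Data.Fin as Fin using (Fin; toℕ; fromℕ; fromℕ<; inject₁)
import Data.Fin.Properties as Fin
open import Data.Integer as ℤ using (ℤ; -[1+_]; _≟_)
import Data.Integer.Properties as ℤ
open import Data.List using (List; []; _∷_; [_]; _++_; map; length; applyUpTo; upTo; lookup; tabulate)
import Data.List.Properties as List
open import Data.List.Membership.Propositional using (_∈_)
open import Data.List.Membership.Propositional.Properties using (∈-map⁺; ∈-map⁻; ∈-++⁺ˡ; ∈-++⁺ʳ; ∈-++⁻)
open import Data.List.Relation.Unary.Any using (here; there)
open import Data.List.Relation.Unary.All as All using (All; []; _∷_)
import Data.List.Relation.Unary.All.Properties as All
open import Data.List.Relation.Unary.AllPairs using (AllPairs; []; _∷_)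
import Data.List.Relation.Unary.AllPairs.Properties as AllPairs
open import Data.List.Relation.Unary.Linked as Linked using (Linked; []; [-]; _∷_)
import Data.List.Relation.Unary.Linked.Properties as Linked
open import Data.List.Relation.Unary.Unique.Propositional using (Unique)
open import Data.List.Relation.Unary.Unique.Propositional.Properties using (map⁺; ++⁺)
open import Data.Nat using (ℕ; zero; suc; _+_; _*_; _≤_; _<_; z≤n; s≤s; NonZero; >-nonZero; >-nonZero⁻¹)
import Data.Nat.Properties as ℕ
open import Data.Nat.Combinatorics using (_C_; nC1≡n; nCk+nC[k+1]≡[n+1]C[k+1])
open import Data.Nat.Tactic.RingSolver using (solve-∀)
open import Data.Product using (Σ; ∃; ∃₂; _×_; _,_; proj₁; proj₂; uncurry)
import Data.Product as Product
open import Data.Product.Properties using (×-≡,≡←≡)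
open import Data.Sum using (inj₁; inj₂; [_,_]′)
open import Function.Base using (_∘_; id)
open import Function.Bundles using (mk⇔; Equivalence)
open import Relation.Binary.PropositionalEquality hiding ([_])
open import Relation.Nullary using (¬_; yes; no; does)
open import Relation.Nullary.Decidable using (toSum)

Unique-map⁺-∈ : {A B : Set} {f : A → B} {xs : List A} →
  (∀ {x y} → x ∈ xs → y ∈ xs → f x ≡ f y → x ≡ y) → Unique xs → Unique (map f xs)
Unique-map⁺-∈ {xs = []}    inj []         = []
Unique-map⁺-∈ {xs = x ∷ xs} inj (x∉ ∷ xs!) =
  All.map⁺ (All.tabulate (λ y∈ fx≡fy → All.lookup x∉ y∈ (inj (here refl) (there y∈) fx≡fy)))
  ∷ Unique-map⁺-∈ (λ x∈ y∈ → inj (there x∈) (there y∈)) xs!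

∈-map-elim : {A B : Set} {f : A → B} {xs : List A} (Q : B → Set) →
  (∀ {x} → x ∈ xs → Q (f x)) → ∀ {y} → y ∈ map f xs → Q y
∈-map-elim Q h m with ∈-map⁻ _ m
... | _ , x∈ , refl = h x∈

module _ {A : Set} {_<_ : A → A → Set} (<-irrefl : ∀ {x} → ¬ x < x)
         (<-trans : ∀ {x y z} → x < y → y < z → x < z) where

  sorted-≡ : ∀ {xs ys} → AllPairs _<_ xs → AllPairs _<_ ys →
             (∀ {x} → x ∈ xs → x ∈ ys) → (∀ {y} → y ∈ ys → y ∈ xs) → xs ≡ ys
  sorted-≡ {[]}     {[]}     _ _ _ _ = refl
  sorted-≡ {[]}     {y ∷ ys} _ _ _ g with g (here refl)
  ... | ()
  sorted-≡ {x ∷ xs} {[]}     _ _ f _ with f (here refl)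
  ... | ()
  sorted-≡ {x ∷ xs} {y ∷ ys} (x< ∷ xs<) (y< ∷ ys<) f g = cong₂ _∷_ x≡y (sorted-≡ xs< ys< f′ g′)
    where
    x≡y : x ≡ y
    x≡y with f (here refl) | g (here refl)
    ... | here e    | _         = e
    ... | there _   | here e    = sym e
    ... | there x∈  | there y∈  = ⊥-elim (<-irrefl (<-trans (All.lookup y< x∈) (All.lookup x< y∈)))
    f′ : ∀ {z} → z ∈ xs → z ∈ ys
    f′ z∈ with f (there z∈)
    ... | there z∈′ = z∈′
    ... | here refl = ⊥-elim (<-irrefl (subst (x <_) (sym x≡y) (All.lookup x< z∈)))
    g′ : ∀ {z} → z ∈ ys → z ∈ xs
    g′ z∈ with g (there z∈)
    ... | there z∈′ = z∈′
    ... | here refl = ⊥-elim (<-irrefl (subst (y <_) x≡y (All.lookup y< z∈)))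

data Nth {A : Set} : List A → ℕ → A → Set where
  zero : ∀ {x xs} → Nth (x ∷ xs) 0 x
  suc  : ∀ {x xs k y} → Nth xs k y → Nth (x ∷ xs) (suc k) y

Nth-functional : ∀ {A : Set} {xs : List A} {k x y} → Nth xs k x → Nth xs k y → x ≡ y
Nth-functional zero    zero    = refl
Nth-functional (suc p) (suc q) = Nth-functional p q

Nth⇒< : ∀ {A : Set} {xs : List A} {k x} → Nth xs k x → k < length xs
Nth⇒< zero    = s≤s z≤n
Nth⇒< (suc p) = s≤s (Nth⇒< p)

<⇒Nth : ∀ {A : Set} (xs : List A) {k} → k < length xs → ∃ (Nth xs k)
<⇒Nth (x ∷ xs) {zero}  _       = x , zero
<⇒Nth (x ∷ xs) {suc k} (s≤s p) with <⇒Nth xs p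
... | y , q = y , suc q

Nth⇒∈ : ∀ {A : Set} {xs : List A} {k x} → Nth xs k x → x ∈ xs
Nth⇒∈ zero    = here refl
Nth⇒∈ (suc p) = there (Nth⇒∈ p)

Nth-lookup : ∀ {A : Set} (xs : List A) i → Nth xs (toℕ i) (lookup xs i)
Nth-lookup (x ∷ xs) Fin.zero    = zero
Nth-lookup (x ∷ xs) (Fin.suc i) = suc (Nth-lookup xs i)

Nth-tabulate⁺ : ∀ {A : Set} {n} (f : Fin n → A) i → Nth (tabulate f) (toℕ i) (f i)
Nth-tabulate⁺ f Fin.zero    = zero
Nth-tabulate⁺ f (Fin.suc i) = suc (Nth-tabulate⁺ (f ∘ Fin.suc) i)

Nth-tabulate⁻ : ∀ {A : Set} {n} (f : Fin n → A) {k x} →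
                Nth (tabulate f) k x → ∃ λ i → toℕ i ≡ k × x ≡ f i
Nth-tabulate⁻ {n = suc n} f zero    = Fin.zero , refl , refl
Nth-tabulate⁻ {n = suc n} f (suc p) with Nth-tabulate⁻ (f ∘ Fin.suc) p
... | i , refl , refl = Fin.suc i , refl , refl

tabulate-∷ʳ : ∀ {A : Set} {n} (f : Fin (suc n) → A) →
              tabulate f ≡ tabulate (f ∘ inject₁) ++ [ f (fromℕ n) ]
tabulate-∷ʳ {n = zero}  f = refl
tabulate-∷ʳ {n = suc n} f = cong (f Fin.zero ∷_) (tabulate-∷ʳ (f ∘ Fin.suc))

tabulate-[] : ∀ {A : Set} {n} (f : Fin n → A) → n ≡ 0 → tabulate f ≡ []
tabulate-[] f refl = refl

applyUpTo≡tabulate : ∀ {A : Set} (g : ℕ → A) n → applyUpTo g n ≡ tabulate {n = n} (g ∘ toℕ)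
applyUpTo≡tabulate g zero    = refl
applyUpTo≡tabulate g (suc n) = cong (g 0 ∷_) (applyUpTo≡tabulate (g ∘ suc) n)

map-oneTo : ∀ {A : Set} (h : ℕ → A) n → map h (oneTo n) ≡ tabulate {n = n} (h ∘ suc ∘ toℕ)
map-oneTo h n = trans (sym (List.map-∘ (upTo n)))
                      (trans (List.map-applyUpTo id (h ∘ suc) n) (applyUpTo≡tabulate (h ∘ suc) n))

Enumerates-map : {A B : Set} {P : A → Set} {Q : B → Set} {f : A → B} {xs : List A} →
  (∀ {x y} → f x ≡ f y → x ≡ y) → (∀ x → P x → Q (f x)) →
  (∀ {y} → Q y → ∃ λ x → P x × y ≡ f x) →
  Enumerates P xs → Enumerates Q (map f xs)
Enumerates-map {Q = Q} {f = f} {xs = xs} f-injective P⇒Q Q⇒P (unique , xs⇔P) =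
  map⁺ f-injective unique , λ y → mk⇔ sound complete
  where
  sound : ∀ {y} → y ∈ map f xs → Q y
  sound y∈ with ∈-map⁻ f y∈
  ... | x , x∈ , refl = P⇒Q x (Equivalence.to (xs⇔P x) x∈)
  complete : ∀ {y} → Q y → y ∈ map f xs
  complete Qy with Q⇒P Qy
  ... | x , Px , refl = ∈-map⁺ f (Equivalence.from (xs⇔P x) Px)

-- The counting recurrence

[1+k]*nC[1+k]+k*nCk≡n*nCk : ∀ n k → suc k * (n C suc k) + k * (n C k) ≡ n * (n C k)
[1+k]*nC[1+k]+k*nCk≡n*nCk zero    zero    = refl
[1+k]*nC[1+k]+k*nCk≡n*nCk zero    (suc k) = cong₂ _+_ (ℕ.*-zeroʳ (2 + k)) (ℕ.*-zeroʳ (suc k))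
[1+k]*nC[1+k]+k*nCk≡n*nCk (suc n) zero    =
  trans (ℕ.+-identityʳ _) (trans (ℕ.*-identityˡ _) (trans (nC1≡n (suc n)) (sym (ℕ.*-identityʳ (suc n)))))
[1+k]*nC[1+k]+k*nCk≡n*nCk (suc n) (suc k) = begin
  (2 + k) * (suc n C (2 + k)) + suc k * (suc n C suc k)
    ≡⟨ cong₂ (λ x y → (2 + k) * x + suc k * y)
             (sym (nCk+nC[k+1]≡[n+1]C[k+1] n (suc k))) (sym (nCk+nC[k+1]≡[n+1]C[k+1] n k)) ⟩
  (2 + k) * (b + c) + suc k * (a + b)
    ≡⟨ regroup k a b c ⟩
  ((2 + k) * c + suc k * b) + (suc k * b + k * a) + (a + b)
    ≡⟨ cong (λ x → x + (a + b)) (cong₂ _+_ ([1+k]*nC[1+k]+k*nCk≡n*nCk n (suc k))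
                                          ([1+k]*nC[1+k]+k*nCk≡n*nCk n k)) ⟩
  n * b + n * a + (a + b)
    ≡⟨ collect n a b ⟩
  suc n * (a + b)
    ≡⟨ cong (suc n *_) (nCk+nC[k+1]≡[n+1]C[k+1] n k) ⟩
  suc n * (suc n C suc k) ∎
  where
  open ≡-Reasoning
  a b c : ℕ
  a = n C k
  b = n C suc k
  c = n C (2 + k)
  regroup : ∀ k a b c → (2 + k) * (b + c) + suc k * (a + b)
                        ≡ ((2 + k) * c + suc k * b) + (suc k * b + k * a) + (a + b)
  regroup = solve-∀
  collect : ∀ n a b → n * b + n * a + (a + b) ≡ suc n * (a + b)
  collect = solve-∀

count : ℕ → ℕ → ℕ → ℕ
count k zero    zero    = 1
count k (suc r) zero    = 0
count k zero    (suc t) = count k zero t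
count k (suc r) (suc t) = count k (suc r) t + count k r (k + t)

count-zero : ∀ k t → count k 0 t ≡ 1
count-zero k zero    = refl
count-zero k (suc t) = count-zero k t

private
  absorption-step : ∀ k r t a b →
    suc (k * suc r + t) * (t * b + (k + t) * a) + k * (suc r * b + r * a)
      ≡ (k * suc r + t) * (suc t * (a + b)) + k * ((k * suc r + t) * a)
  absorption-step = solve-∀

  distrib-step : ∀ m x y → m * (suc m * (x + y)) ≡ suc m * (m * x + m * y)
  distrib-step = solve-∀

  shift : ∀ k r t → k * r + (k + t) ≡ k * suc r + t
  shift = solve-∀

count-closed-form-step : ∀ k .{{_ : NonZero k}} r t →
  (k * suc r + t) * count k (suc r) t ≡ t * ((k * suc r + t) C suc r) →
  (k * r + (k + t)) * count k r (k + t) ≡ (k + t) * ((k * r + (k + t)) C r) →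
  (k * suc r + suc t) * count k (suc r) (suc t) ≡ suc t * ((k * suc r + suc t) C suc r)
count-closed-form-step k r t ih₁ ih₂ = begin
  (k * suc r + suc t) * (N₁ + N₂)  ≡⟨ cong (_* (N₁ + N₂)) (ℕ.+-suc (k * suc r) t) ⟩
  suc M * (N₁ + N₂)                ≡⟨ ℕ.*-cancelˡ-≡ _ _ M {{M≢0}} scaled ⟩
  suc t * (a + b)                  ≡⟨ cong (suc t *_) (nCk+nC[k+1]≡[n+1]C[k+1] M r) ⟩
  suc t * (suc M C suc r)          ≡⟨ cong (λ m → suc t * (m C suc r)) (ℕ.+-suc (k * suc r) t) ⟨
  suc t * ((k * suc r + suc t) C suc r) ∎
  where
  open ≡-Reasoning
  M N₁ N₂ a b : ℕ
  M = k * suc r + t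
  N₁ = count k (suc r) t
  N₂ = count k r (k + t)
  a = M C r
  b = M C suc r
  M≢0 : NonZero M
  M≢0 = >-nonZero (ℕ.≤-trans (>-nonZero⁻¹ (k * suc r) {{ℕ.m*n≢0 k (suc r)}}) (ℕ.m≤m+n (k * suc r) t))
  ih₂′ : M * N₂ ≡ (k + t) * a
  ih₂′ = subst (λ m → m * N₂ ≡ (k + t) * (m C r)) (shift k r t) ih₂
  -- The two sides differ by k times the difference of the two sides of the absorption identity.
  absorbed : suc M * (t * b + (k + t) * a) ≡ M * (suc t * (a + b))
  absorbed = ℕ.+-cancelʳ-≡ (k * (M * a)) _ _ (begin
    suc M * (t * b + (k + t) * a) + k * (M * a)
      ≡⟨ cong (λ x → suc M * (t * b + (k + t) * a) + k * x) ([1+k]*nC[1+k]+k*nCk≡n*nCk M r) ⟨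
    suc M * (t * b + (k + t) * a) + k * (suc r * b + r * a)
      ≡⟨ absorption-step k r t a b ⟩
    M * (suc t * (a + b)) + k * (M * a) ∎)
  scaled : M * (suc M * (N₁ + N₂)) ≡ M * (suc t * (a + b))
  scaled = begin
    M * (suc M * (N₁ + N₂))       ≡⟨ distrib-step M N₁ N₂ ⟩
    suc M * (M * N₁ + M * N₂)     ≡⟨ cong (suc M *_) (cong₂ _+_ ih₁ ih₂′) ⟩
    suc M * (t * b + (k + t) * a) ≡⟨ absorbed ⟩
    M * (suc t * (a + b))         ∎

count-closed-form : ∀ k .{{_ : NonZero k}} r t → (k * r + t) * count k r t ≡ t * ((k * r + t) C r)
count-closed-form k zero    t rewrite ℕ.*-zeroʳ k | count-zero k t = refl
count-closed-form k (suc r) zero    = ℕ.*-zeroʳ (k * suc r + 0)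
count-closed-form k (suc r) (suc t) =
  count-closed-form-step k r t (count-closed-form k (suc r) t) (count-closed-form k r (k + t))

-- Sequences of lists of ternary nodes

data Node : Set where
  node : (below level above : List Node) → Node

mutual
  size : Node → ℕ
  size (node a b c) = suc (sizes a + sizes b + sizes c)

  sizes : List Node → ℕ
  sizes []       = 0
  sizes (n ∷ ns) = size n + sizes ns

weight : List (List Node) → ℕ
weight []       = 0
weight (g ∷ gs) = sizes g + weight gs

Shape : ℕ → ℕ → List (List Node) → Set
Shape r t s = weight s ≡ r × length s ≡ t

-- The junk value on sequences of fewer than four lists is never used.
graft : List (List Node) → List (List Node)
graft (a ∷ b ∷ c ∷ g ∷ gs) = (node a b c ∷ g) ∷ gs
graft _                    = []

sequences : ℕ → ℕ → List (List (List Node))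
sequences zero    zero    = [ [] ]
sequences (suc r) zero    = []
sequences zero    (suc t) = map ([] ∷_) (sequences zero t)
sequences (suc r) (suc t) = map ([] ∷_) (sequences (suc r) t) ++ map graft (sequences r (4 + t))

length-sequences : ∀ r t → length (sequences r t) ≡ count 4 r t
length-sequences zero    zero    = refl
length-sequences (suc r) zero    = refl
length-sequences zero    (suc t) = trans (List.length-map _ (sequences zero t)) (length-sequences zero t)
length-sequences (suc r) (suc t) = begin
  length (map ([] ∷_) (sequences (suc r) t) ++ map graft (sequences r (4 + t)))
    ≡⟨ List.length-++ (map ([] ∷_) (sequences (suc r) t)) ⟩
  length (map ([] ∷_) (sequences (suc r) t)) + length (map graft (sequences r (4 + t)))
    ≡⟨ cong₂ _+_ (List.length-map _ (sequences (suc r) t)) (List.length-map graft (sequences r (4 + t))) ⟩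
  length (sequences (suc r) t) + length (sequences r (4 + t))
    ≡⟨ cong₂ _+_ (length-sequences (suc r) t) (length-sequences r (4 + t)) ⟩
  count 4 (suc r) (suc t) ∎
  where open ≡-Reasoning

weight-graft : ∀ a b c g gs → weight ((node a b c ∷ g) ∷ gs) ≡ suc (weight (a ∷ b ∷ c ∷ g ∷ gs))
weight-graft a b c g gs = regroup (sizes a) (sizes b) (sizes c) (sizes g) (weight gs)
  where
  regroup : ∀ a b c g w → suc (a + b + c) + g + w ≡ suc (a + (b + (c + (g + w))))
  regroup = solve-∀

graft-shape : ∀ {r t s} → Shape r (4 + t) s → Shape (suc r) (suc t) (graft s)
graft-shape {s = a ∷ b ∷ c ∷ g ∷ gs} (refl , refl) = weight-graft a b c g gs , refl
graft-shape {s = []}                 (_ , ())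
graft-shape {s = _ ∷ []}             (_ , ())
graft-shape {s = _ ∷ _ ∷ []}         (_ , ())
graft-shape {s = _ ∷ _ ∷ _ ∷ []}     (_ , ())

graft-injective : ∀ {t s s′} → length s ≡ 4 + t → length s′ ≡ 4 + t → graft s ≡ graft s′ → s ≡ s′
graft-injective {s = _ ∷ _ ∷ _ ∷ _ ∷ _} {_ ∷ _ ∷ _ ∷ _ ∷ _} _ _ refl = refl
graft-injective {s = []}             ()
graft-injective {s = _ ∷ []}         ()
graft-injective {s = _ ∷ _ ∷ []}     ()
graft-injective {s = _ ∷ _ ∷ _ ∷ []} ()
graft-injective {s = _ ∷ _ ∷ _ ∷ _ ∷ _} {[]}             _ ()
graft-injective {s = _ ∷ _ ∷ _ ∷ _ ∷ _} {_ ∷ []}         _ ()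
graft-injective {s = _ ∷ _ ∷ _ ∷ _ ∷ _} {_ ∷ _ ∷ []}     _ ()
graft-injective {s = _ ∷ _ ∷ _ ∷ _ ∷ _} {_ ∷ _ ∷ _ ∷ []} _ ()

[]∷≢graft : ∀ s s′ → [] ∷ s ≢ graft s′
[]∷≢graft s (_ ∷ _ ∷ _ ∷ _ ∷ _) ()
[]∷≢graft s []                   ()
[]∷≢graft s (_ ∷ [])             ()
[]∷≢graft s (_ ∷ _ ∷ [])         ()
[]∷≢graft s (_ ∷ _ ∷ _ ∷ [])     ()

sequences-sound : ∀ r t {s} → s ∈ sequences r t → Shape r t s
sequences-sound zero    zero    (here refl) = refl , refl
sequences-sound zero    (suc t) m =
  ∈-map-elim (Shape zero (suc t)) (Product.map₂ (cong suc) ∘ sequences-sound zero t) m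
sequences-sound (suc r) (suc t) m =
  [ ∈-map-elim (Shape (suc r) (suc t)) (Product.map₂ (cong suc) ∘ sequences-sound (suc r) t)
  , ∈-map-elim (Shape (suc r) (suc t)) (λ {s} → graft-shape {s = s} ∘ sequences-sound r (4 + t))
  ]′ (∈-++⁻ (map ([] ∷_) (sequences (suc r) t)) m)

sequences-complete : ∀ r t {s} → Shape r t s → s ∈ sequences r t
sequences-complete zero    zero    {[]}    _       = here refl
sequences-complete (suc r) zero    {[]}    (() , _)
sequences-complete r       zero    {_ ∷ _} (_ , ())
sequences-complete r       (suc t) {[]}    (_ , ())
sequences-complete zero    (suc t) {[] ∷ s} (w , l) =
  ∈-map⁺ ([] ∷_) (sequences-complete zero t (w , ℕ.suc-injective l))
sequences-complete zero    (suc t) {(node _ _ _ ∷ _) ∷ _} (() , _)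
sequences-complete (suc r) (suc t) {[] ∷ s} (w , l) =
  ∈-++⁺ˡ (∈-map⁺ ([] ∷_) (sequences-complete (suc r) t (w , ℕ.suc-injective l)))
sequences-complete (suc r) (suc t) {(node a b c ∷ g) ∷ s} (w , l) =
  ∈-++⁺ʳ (map ([] ∷_) (sequences (suc r) t)) (∈-map⁺ graft
    (sequences-complete r (4 + t) (ℕ.suc-injective (trans (sym (weight-graft a b c g s)) w) , cong (3 +_) l)))

sequences-unique : ∀ r t → Unique (sequences r t)
sequences-unique zero    zero    = [] ∷ []
sequences-unique (suc r) zero    = []
sequences-unique zero    (suc t) = map⁺ List.∷-injectiveʳ (sequences-unique zero t)
sequences-unique (suc r) (suc t) =
  ++⁺ (map⁺ List.∷-injectiveʳ (sequences-unique (suc r) t))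
      (Unique-map⁺-∈ (λ x∈ y∈ → graft-injective (shape x∈) (shape y∈)) (sequences-unique r (4 + t)))
      disjoint
  where
  shape : ∀ {s} → s ∈ sequences r (4 + t) → length s ≡ 4 + t
  shape m = Product.proj₂ (sequences-sound r (4 + t) m)
  disjoint : ∀ {v} → v ∈ map ([] ∷_) (sequences (suc r) t) × v ∈ map graft (sequences r (4 + t)) → ⊥
  disjoint (p , q) with ∈-map⁻ ([] ∷_) p | ∈-map⁻ graft q
  ... | s , _ , refl | s′ , _ , e = []∷≢graft s s′ e

sequences-enumerates : ∀ r t → Enumerates (Shape r t) (sequences r t)
sequences-enumerates r t = sequences-unique r t , λ _ → mk⇔ (sequences-sound r t) (sequences-complete r t)

-- Words and labelled trees

<w-trans : ∀ {u v w} → u <w v → v <w w → u <w w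
<w-trans []<∷      (here _)  = []<∷
<w-trans []<∷      (there _) = []<∷
<w-trans (here p)  (here q)  = here (ℕ.<-trans p q)
<w-trans (here p)  (there _) = here p
<w-trans (there _) (here q)  = here q
<w-trans (there p) (there q) = there (<w-trans p q)

<w-irrefl : ∀ {u} → ¬ u <w u
<w-irrefl (here p)  = ℕ.<-irrefl refl p
<w-irrefl (there p) = <w-irrefl p

<w-++ : ∀ p {a} v → p <w (p ++ (a ∷ v))
<w-++ []      v = []<∷
<w-++ (x ∷ p) v = there (<w-++ p v)

<w-++-mono : ∀ p {a b} v v′ → a < b → (p ++ (a ∷ v)) <w (p ++ (b ∷ v′))
<w-++-mono []      v v′ a<b = here a<b
<w-++-mono (x ∷ p) v v′ a<b = there (<w-++-mono p v v′ a<b)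

_≺_ : Word × ℤ → Word × ℤ → Set
x ≺ y = proj₁ x <w proj₁ y

lab-∈ : ∀ L {w z} → AllPairs _≺_ L → (w , z) ∈ L → lab L w ≡ z
lab-∈ ((v , _) ∷ L) {w} (v< ∷ L<) w∈ with List.≡-dec ℕ._≟_ w v
lab-∈ ((v , _) ∷ L) (v< ∷ L<) (here refl) | yes _    = refl
lab-∈ ((v , _) ∷ L) (v< ∷ L<) (there w∈)  | yes refl = ⊥-elim (<w-irrefl (All.lookup v< w∈))
lab-∈ ((v , _) ∷ L) (v< ∷ L<) (here refl) | no w≢v   = ⊥-elim (w≢v refl)
lab-∈ ((v , _) ∷ L) (v< ∷ L<) (there w∈)  | no _     = lab-∈ L L< w∈

data Tree : Set where
  tree : ℤ → List Tree → Tree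

label : Tree → ℤ
label (tree z _) = z

subtrees : Tree → List Tree
subtrees (tree _ cs) = cs

-- Addresses number children from 1, as in the words of a forest.
data At : Tree → Word → Tree → Set where
  here : ∀ {t} → At t [] t
  down : ∀ {z cs j c v s} → Nth cs j c → At c v s → At (tree z cs) (suc j ∷ v) s

At-functional : ∀ {t v s s′} → At t v s → At t v s′ → s ≡ s′
At-functional here       here       = refl
At-functional (down p a) (down q b) with Nth-functional p q
... | refl = At-functional a b

At-++⁻ : ∀ {t} u {v s} → At t (u ++ v) s → ∃ λ s′ → At t u s′ × At s′ v s
At-++⁻ []      a          = _ , here , a
At-++⁻ (_ ∷ u) (down p a) with At-++⁻ u a
... | s′ , b , c = s′ , down p b , c

At-++⁺ : ∀ {t u v s s′} → At t u s′ → At s′ v s → At t (u ++ v) s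
At-++⁺ here       b = b
At-++⁺ (down p a) b = down p (At-++⁺ a b)

At-positive : ∀ {t v s} → At t v s → All (1 ≤_) v
At-positive here       = []
At-positive (down _ a) = s≤s z≤n ∷ At-positive a

mutual
  vertices : Tree → ℕ
  vertices (tree _ cs) = suc (vertices* cs)

  vertices* : List Tree → ℕ
  vertices* []       = 0
  vertices* (c ∷ cs) = vertices c + vertices* cs

vertices*-++ : ∀ cs ds → vertices* (cs ++ ds) ≡ vertices* cs + vertices* ds
vertices*-++ []       ds = refl
vertices*-++ (c ∷ cs) ds = trans (cong (vertices c +_) (vertices*-++ cs ds)) (sym (ℕ.+-assoc (vertices c) _ _))

mutual
  encode : Word → Tree → LForest
  encode p (tree z cs) = (p , z) ∷ encodeChildren p 0 cs

  encodeChildren : Word → ℕ → List Tree → LForest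
  encodeChildren p k []       = []
  encodeChildren p k (c ∷ cs) = encode (p ++ [ suc k ]) c ++ encodeChildren p (suc k) cs

private
  ++-snoc : ∀ p (a : ℕ) v → (p ++ [ a ]) ++ v ≡ p ++ (a ∷ v)
  ++-snoc p a v = List.++-assoc p [ a ] v

mutual
  ∈-encode⁻ : ∀ p t {x} → x ∈ encode p t → ∃₂ λ v s → At t v s × x ≡ (p ++ v , label s)
  ∈-encode⁻ p (tree z cs) (here refl) = [] , tree z cs , here , cong (_, z) (sym (List.++-identityʳ p))
  ∈-encode⁻ p (tree z cs) (there x∈) with ∈-encodeChildren⁻ p 0 cs x∈
  ... | j , c , v , s , n , a , refl = suc j ∷ v , s , down n a , refl

  ∈-encodeChildren⁻ : ∀ p k cs {x} → x ∈ encodeChildren p k cs →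
    ∃ λ j → ∃ λ c → ∃₂ λ v s → Nth cs j c × At c v s × x ≡ (p ++ (suc (k + j) ∷ v) , label s)
  ∈-encodeChildren⁻ p k (c ∷ cs) x∈ with ∈-++⁻ (encode (p ++ [ suc k ]) c) x∈
  ... | inj₁ x∈c with ∈-encode⁻ (p ++ [ suc k ]) c x∈c
  ...   | v , s , a , refl = 0 , c , v , s , zero , a ,
          cong (_, label s) (trans (++-snoc p (suc k) v) (cong (λ i → p ++ (suc i ∷ v)) (sym (ℕ.+-identityʳ k))))
  ∈-encodeChildren⁻ p k (c ∷ cs) x∈ | inj₂ x∈cs with ∈-encodeChildren⁻ p (suc k) cs x∈cs
  ...   | j , c′ , v , s , n , a , refl = suc j , c′ , v , s , suc n , a ,
          cong (λ i → p ++ (suc i ∷ v) , label s) (sym (ℕ.+-suc k j))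

mutual
  ∈-encode⁺ : ∀ p t {v s} → At t v s → (p ++ v , label s) ∈ encode p t
  ∈-encode⁺ p (tree z cs) here       = here (cong (_, z) (List.++-identityʳ p))
  ∈-encode⁺ p (tree z cs) (down n a) = there (∈-encodeChildren⁺ p 0 cs n a)

  ∈-encodeChildren⁺ : ∀ p k cs {j c v s} → Nth cs j c → At c v s →
    (p ++ (suc (k + j) ∷ v) , label s) ∈ encodeChildren p k cs
  ∈-encodeChildren⁺ p k (c ∷ cs) {v = v} {s} zero a =
    ∈-++⁺ˡ (subst (λ w → (w , label s) ∈ encode (p ++ [ suc k ]) c)
             (trans (++-snoc p (suc k) v) (cong (λ i → p ++ (suc i ∷ v)) (sym (ℕ.+-identityʳ k))))
             (∈-encode⁺ (p ++ [ suc k ]) c a))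
  ∈-encodeChildren⁺ p k (c ∷ cs) {suc j} {v = v} {s = s} (suc n) a =
    ∈-++⁺ʳ (encode (p ++ [ suc k ]) c)
      (subst (λ i → (p ++ (suc i ∷ v) , label s) ∈ encodeChildren p (suc k) cs) (sym (ℕ.+-suc k j))
             (∈-encodeChildren⁺ p (suc k) cs n a))

mutual
  encode-sorted : ∀ p t → AllPairs _≺_ (encode p t)
  encode-sorted p (tree z cs) = All.tabulate root-first ∷ encodeChildren-sorted p 0 cs
    where
    root-first : ∀ {x} → x ∈ encodeChildren p 0 cs → (p , z) ≺ x
    root-first x∈ with ∈-encodeChildren⁻ p 0 cs x∈
    ... | j , c , v , s , n , a , refl = <w-++ p v

  encodeChildren-sorted : ∀ p k cs → AllPairs _≺_ (encodeChildren p k cs)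
  encodeChildren-sorted p k []       = []
  encodeChildren-sorted p k (c ∷ cs) =
    AllPairs.++⁺ (encode-sorted (p ++ [ suc k ]) c) (encodeChildren-sorted p (suc k) cs)
                 (All.tabulate λ x∈ → All.tabulate λ y∈ → earlier-child-first x∈ y∈)
    where
    earlier-child-first : ∀ {x y} → x ∈ encode (p ++ [ suc k ]) c → y ∈ encodeChildren p (suc k) cs → x ≺ y
    earlier-child-first x∈ y∈ with ∈-encode⁻ (p ++ [ suc k ]) c x∈ | ∈-encodeChildren⁻ p (suc k) cs y∈
    ... | v , s , a , refl | j , c′ , v′ , s′ , n , a′ , refl =
      subst (_<w (p ++ (suc (suc k + j) ∷ v′))) (sym (++-snoc p (suc k) v))
            (<w-++-mono p v v′ (s≤s (s≤s (ℕ.m≤m+n k j))))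

mutual
  length-encode : ∀ p t → length (encode p t) ≡ vertices t
  length-encode p (tree z cs) = cong suc (length-encodeChildren p 0 cs)

  length-encodeChildren : ∀ p k cs → length (encodeChildren p k cs) ≡ vertices* cs
  length-encodeChildren p k []       = refl
  length-encodeChildren p k (c ∷ cs) =
    trans (List.length-++ (encode (p ++ [ suc k ]) c)) (cong₂ _+_ (length-encode _ c) (length-encodeChildren p (suc k) cs))

encodeForest : List Tree → LForest
encodeForest = encodeChildren [] 0

module _ {z : ℤ} (R : List Tree) where

  ∈-encodeForest⁻ : ∀ {x} → x ∈ encodeForest R →
                    ∃₂ λ w s → At (tree z R) w s × w ≢ [] × x ≡ (w , label s)
  ∈-encodeForest⁻ x∈ with ∈-encodeChildren⁻ [] 0 R x∈
  ... | j , c , v , s , n , a , refl = suc j ∷ v , s , down n a , (λ ()) , refl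

  ∈-encodeForest⁺ : ∀ {w s} → At (tree z R) w s → w ≢ [] → (w , label s) ∈ encodeForest R
  ∈-encodeForest⁺ here       w≢[] = ⊥-elim (w≢[] refl)
  ∈-encodeForest⁺ (down n a) _    = ∈-encodeChildren⁺ [] 0 R n a

_⊑_ : Tree → Tree → Set
t ⊑ t′ = ∀ {v s} → At t v s → ∃ λ s′ → At t′ v s′ × label s ≡ label s′

private
  ⊑-head : ∀ {z z′ c c′ cs cs′} → tree z (c ∷ cs) ⊑ tree z′ (c′ ∷ cs′) → c ⊑ c′
  ⊑-head h a with h (down zero a)
  ... | s′ , down zero a′ , e = s′ , a′ , e

  ⊑-tail : ∀ {z z′ c c′ cs cs′} → tree z (c ∷ cs) ⊑ tree z′ (c′ ∷ cs′) →
           tree z cs ⊑ tree z′ cs′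
  ⊑-tail h here with h here
  ... | _ , here , e = _ , here , e
  ⊑-tail h (down n a) with h (down (suc n) a)
  ... | s′ , down (suc n′) a′ , e = s′ , down n′ a′ , e

mutual
  ⊑-antisym : ∀ {t t′} → t ⊑ t′ → t′ ⊑ t → t ≡ t′
  ⊑-antisym {tree z cs} {tree z′ cs′} h h′ with h here
  ... | _ , here , refl = cong (tree z) (subtrees-≡ cs cs′ h h′)

  subtrees-≡ : ∀ {z z′} cs cs′ → tree z cs ⊑ tree z′ cs′ → tree z′ cs′ ⊑ tree z cs → cs ≡ cs′
  subtrees-≡ []       []         _ _  = refl
  subtrees-≡ []       (_ ∷ _)    _ h′ with h′ (down zero here)
  ... | _ , down () _ , _
  subtrees-≡ (_ ∷ _)  []         h _  with h (down zero here)
  ... | _ , down () _ , _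
  subtrees-≡ (c ∷ cs) (c′ ∷ cs′) h h′ =
    cong₂ _∷_ (⊑-antisym (⊑-head h) (⊑-head h′)) (subtrees-≡ cs cs′ (⊑-tail h) (⊑-tail h′))

encodeForest-injective : ∀ {R R′} → encodeForest R ≡ encodeForest R′ → R ≡ R′
encodeForest-injective {R} {R′} eq = subtrees-≡ {ℤ.+ 0} {ℤ.+ 0} R R′ (⊑-from eq) (⊑-from (sym eq))
  where
  ⊑-from : ∀ {R R′} → encodeForest R ≡ encodeForest R′ → tree (ℤ.+ 0) R ⊑ tree (ℤ.+ 0) R′
  ⊑-from eq here = _ , here , refl
  ⊑-from {R} {R′} eq a@(down _ _) with ∈-encodeForest⁻ R′ (subst (_ ∈_) eq (∈-encodeForest⁺ R a (λ ())))
  ... | _ , s′ , a′ , _ , e with ×-≡,≡←≡ e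
  ...   | refl , e′ = s′ , a′ , e′

-- Well-labelled trees

lower upper : ℤ → ℤ
lower ℓ = ℓ ℤ.- ℤ.+ 1
upper ℓ = ℓ ℤ.+ ℤ.+ 1

lower<ℓ : ∀ ℓ → lower ℓ ℤ.< ℓ
lower<ℓ ℓ = subst (ℤ._< ℓ) (ℤ.+-comm ℤ.-1ℤ ℓ) (ℤ.i≤pred[j]⇒i<j ℤ.≤-refl)

ℓ<upper : ∀ ℓ → ℓ ℤ.< upper ℓ
ℓ<upper ℓ = subst (ℓ ℤ.<_) (ℤ.+-comm ℤ.1ℤ ℓ) (ℤ.suc[i]≤j⇒i<j ℤ.≤-refl)

lower<upper : ∀ ℓ → lower ℓ ℤ.< upper ℓ
lower<upper ℓ = ℤ.<-trans (lower<ℓ ℓ) (ℓ<upper ℓ)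

lower≤∧≢⇒≥ : ∀ {ℓ x} → lower ℓ ℤ.≤ x → lower ℓ ≢ x → ℓ ℤ.≤ x
lower≤∧≢⇒≥ {ℓ} p ne = subst (ℤ._≤ _) (trans (cong ℤ.suc (ℤ.+-comm ℓ ℤ.-1ℤ)) (ℤ.suc-pred ℓ))
                              (ℤ.i<j⇒suc[i]≤j (ℤ.≤∧≢⇒< p ne))

≤∧≢⇒upper≤ : ∀ {ℓ x} → ℓ ℤ.≤ x → ℓ ≢ x → upper ℓ ℤ.≤ x
≤∧≢⇒upper≤ {ℓ} p ne = subst (ℤ._≤ _) (ℤ.+-comm ℤ.1ℤ ℓ) (ℤ.i<j⇒suc[i]≤j (ℤ.≤∧≢⇒< p ne))

Chain : ℤ → List Tree → ℤ → Set
Chain lo cs hi = Linked ℤ._≤_ (lo ∷ (map label cs ++ [ hi ]))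

data WellLabelled : Tree → Set where
  tree : ∀ {ℓ cs} → Chain (lower ℓ) cs (upper ℓ) → All WellLabelled cs → WellLabelled (tree ℓ cs)

mutual
  toTree : ℤ → Node → Tree
  toTree ℓ n = tree ℓ (toSubtrees ℓ n)

  toSubtrees : ℤ → Node → List Tree
  toSubtrees ℓ (node a b c) = toTrees (lower ℓ) a ++ toTrees ℓ b ++ toTrees (upper ℓ) c

  toTrees : ℤ → List Node → List Tree
  toTrees x []       = []
  toTrees x (n ∷ ns) = toTree x n ∷ toTrees x ns

addBelow : Node → Node → Node
addBelow x (node a b c) = node (x ∷ a) b c

mutual
  fromTree : Tree → Node
  fromTree (tree ℓ cs) = gatherBelow ℓ cs

  fromTrees : List Tree → List Node
  fromTrees []       = []
  fromTrees (c ∷ cs) = fromTree c ∷ fromTrees cs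

  gatherBelow : ℤ → List Tree → Node
  gatherBelow ℓ []       = node [] [] []
  gatherBelow ℓ (c ∷ cs) =
    if does (label c ≟ lower ℓ) then addBelow (fromTree c) (gatherBelow ℓ cs)
                                else uncurry (node []) (gatherLevel ℓ (c ∷ cs))

  gatherLevel : ℤ → List Tree → List Node × List Node
  gatherLevel ℓ []       = [] , []
  gatherLevel ℓ (c ∷ cs) =
    if does (label c ≟ ℓ) then Product.map₁ (fromTree c ∷_) (gatherLevel ℓ cs)
                          else ([] , fromTrees (c ∷ cs))

module _ (ℓ : ℤ) (c : Tree) (cs : List Tree) where

  gatherBelow-lower : label c ≡ lower ℓ →
                      gatherBelow ℓ (c ∷ cs) ≡ addBelow (fromTree c) (gatherBelow ℓ cs)
  gatherBelow-lower e with label c ≟ lower ℓ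
  ... | yes _ = refl
  ... | no ne = ⊥-elim (ne e)

  gatherBelow-other : label c ≢ lower ℓ →
                      gatherBelow ℓ (c ∷ cs) ≡ uncurry (node []) (gatherLevel ℓ (c ∷ cs))
  gatherBelow-other ne with label c ≟ lower ℓ
  ... | yes e = ⊥-elim (ne e)
  ... | no _  = refl

  gatherLevel-level : label c ≡ ℓ →
                      gatherLevel ℓ (c ∷ cs) ≡ Product.map₁ (fromTree c ∷_) (gatherLevel ℓ cs)
  gatherLevel-level e with label c ≟ ℓ
  ... | yes _ = refl
  ... | no ne = ⊥-elim (ne e)

  gatherLevel-other : label c ≢ ℓ → gatherLevel ℓ (c ∷ cs) ≡ ([] , fromTrees (c ∷ cs))
  gatherLevel-other ne with label c ≟ ℓ
  ... | yes e = ⊥-elim (ne e)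
  ... | no _  = refl

mutual
  fromTree-toTree : ∀ ℓ n → fromTree (toTree ℓ n) ≡ n
  fromTree-toTree ℓ (node a b c) = gatherBelow-toTrees ℓ a b c

  gatherBelow-toTrees : ∀ ℓ a b c →
    gatherBelow ℓ (toTrees (lower ℓ) a ++ toTrees ℓ b ++ toTrees (upper ℓ) c) ≡ node a b c
  gatherBelow-toTrees ℓ (n ∷ a) b c = trans (gatherBelow-lower ℓ (toTree (lower ℓ) n) _ refl)
    (cong₂ addBelow (fromTree-toTree (lower ℓ) n) (gatherBelow-toTrees ℓ a b c))
  gatherBelow-toTrees ℓ [] (n ∷ b) c =
    trans (gatherBelow-other ℓ (toTree ℓ n) _ (ℤ.<⇒≢ (lower<ℓ ℓ) ∘ sym))
    (cong (uncurry (node [])) (gatherLevel-toTrees ℓ (n ∷ b) c))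
  gatherBelow-toTrees ℓ [] [] (n ∷ c) =
    trans (gatherBelow-other ℓ (toTree (upper ℓ) n) _ (ℤ.<⇒≢ (lower<upper ℓ) ∘ sym))
    (cong (uncurry (node [])) (gatherLevel-toTrees ℓ [] (n ∷ c)))
  gatherBelow-toTrees ℓ [] [] [] = refl

  gatherLevel-toTrees : ∀ ℓ b c → gatherLevel ℓ (toTrees ℓ b ++ toTrees (upper ℓ) c) ≡ (b , c)
  gatherLevel-toTrees ℓ (n ∷ b) c = trans (gatherLevel-level ℓ (toTree ℓ n) _ refl)
    (cong₂ (λ x → Product.map₁ (x ∷_)) (fromTree-toTree ℓ n) (gatherLevel-toTrees ℓ b c))
  gatherLevel-toTrees ℓ [] (n ∷ c) =
    trans (gatherLevel-other ℓ (toTree (upper ℓ) n) _ (ℤ.<⇒≢ (ℓ<upper ℓ) ∘ sym))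
    (cong ([] ,_) (fromTrees-toTrees (upper ℓ) (n ∷ c)))
  gatherLevel-toTrees ℓ [] [] = refl

  fromTrees-toTrees : ∀ x ns → fromTrees (toTrees x ns) ≡ ns
  fromTrees-toTrees x []       = refl
  fromTrees-toTrees x (n ∷ ns) = cong₂ _∷_ (fromTree-toTree x n) (fromTrees-toTrees x ns)

toTrees-injective : ∀ x {ns ns′} → toTrees x ns ≡ toTrees x ns′ → ns ≡ ns′
toTrees-injective x {ns} {ns′} eq =
  trans (sym (fromTrees-toTrees x ns)) (trans (cong fromTrees eq) (fromTrees-toTrees x ns′))

chain-bound : ∀ {lo hi} cs → Chain lo cs hi → lo ℤ.≤ hi
chain-bound []       (p ∷ [-]) = p
chain-bound (c ∷ cs) (p ∷ l)   = ℤ.≤-trans p (chain-bound cs l)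

private
  chain-tail : ∀ {lo x} c {cs hi} → label c ≡ x → Chain lo (c ∷ cs) hi → Chain x cs hi
  chain-tail c refl ch = Linked.tail ch

  toSubtrees-addBelow : ∀ ℓ x n → toSubtrees ℓ (addBelow x n) ≡ toTree (lower ℓ) x ∷ toSubtrees ℓ n
  toSubtrees-addBelow ℓ x (node a b c) = refl

chain-squeeze : ∀ {x} cs → Chain x cs x → All (λ c → label c ≡ x) cs
chain-squeeze []       _  = []
chain-squeeze {x} (c ∷ cs) ch =
  label≡x ∷ chain-squeeze cs (chain-tail c label≡x ch)
  where
  label≡x : label c ≡ x
  label≡x = ℤ.≤-antisym (chain-bound cs (Linked.tail ch)) (Linked.head ch)

mutual
  toTree-fromTree : ∀ {x t} → label t ≡ x → WellLabelled t → toTree x (fromTree t) ≡ t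
  toTree-fromTree refl (tree {ℓ} {cs} ch ws) = cong (tree ℓ) (toSubtrees-gatherBelow ℓ cs ch ws)

  toSubtrees-gatherBelow : ∀ ℓ cs → Chain (lower ℓ) cs (upper ℓ) → All WellLabelled cs →
    toSubtrees ℓ (gatherBelow ℓ cs) ≡ cs
  toSubtrees-gatherBelow ℓ []       _  []       = refl
  toSubtrees-gatherBelow ℓ (c ∷ cs) ch (w ∷ ws) =
    [ (λ e → trans (cong (toSubtrees ℓ) (gatherBelow-lower ℓ c cs e))
               (trans (toSubtrees-addBelow ℓ (fromTree c) (gatherBelow ℓ cs))
                 (cong₂ _∷_ (toTree-fromTree e w) (toSubtrees-gatherBelow ℓ cs (chain-tail c e ch) ws))))
    , (λ ne → trans (cong (toSubtrees ℓ) (gatherBelow-other ℓ c cs ne))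
                (toSubtrees-gatherLevel ℓ (c ∷ cs)
                   (lower≤∧≢⇒≥ (Linked.head ch) (ne ∘ sym) ∷ Linked.tail ch) (w ∷ ws)))
    ]′ (toSum (label c ≟ lower ℓ))

  toSubtrees-gatherLevel : ∀ ℓ cs → Chain ℓ cs (upper ℓ) → All WellLabelled cs →
    toSubtrees ℓ (uncurry (node []) (gatherLevel ℓ cs)) ≡ cs
  toSubtrees-gatherLevel ℓ []       _  []       = refl
  toSubtrees-gatherLevel ℓ (c ∷ cs) ch (w ∷ ws) =
    [ (λ e → trans (cong (toSubtrees ℓ ∘ uncurry (node [])) (gatherLevel-level ℓ c cs e))
               (cong₂ _∷_ (toTree-fromTree e w) (toSubtrees-gatherLevel ℓ cs (chain-tail c e ch) ws)))
    , (λ ne → trans (cong (toSubtrees ℓ ∘ uncurry (node [])) (gatherLevel-other ℓ c cs ne))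
                (toTrees-fromTrees (upper ℓ) (c ∷ cs)
                   (chain-squeeze (c ∷ cs) (≤∧≢⇒upper≤ (Linked.head ch) (ne ∘ sym) ∷ Linked.tail ch)) (w ∷ ws)))
    ]′ (toSum (label c ≟ ℓ))

  toTrees-fromTrees : ∀ x cs → All (λ c → label c ≡ x) cs → All WellLabelled cs →
                      toTrees x (fromTrees cs) ≡ cs
  toTrees-fromTrees x []       []       []       = refl
  toTrees-fromTrees x (c ∷ cs) (e ∷ es) (w ∷ ws) =
    cong₂ _∷_ (toTree-fromTree e w) (toTrees-fromTrees x cs es ws)

private
  label-chain : ∀ {lo x} ns {rest} → lo ℤ.≤ x → Linked ℤ._≤_ (x ∷ rest) →
                Linked ℤ._≤_ (lo ∷ (map label (toTrees x ns) ++ rest))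
  label-chain []       lo≤x [-]       = [-]
  label-chain []       lo≤x (p ∷ l)   = ℤ.≤-trans lo≤x p ∷ l
  label-chain (n ∷ ns) lo≤x l         = lo≤x ∷ label-chain ns ℤ.≤-refl l

  map-label-++ : ∀ cs ds rest → map label (cs ++ ds) ++ rest ≡ map label cs ++ (map label ds ++ rest)
  map-label-++ cs ds rest = trans (cong (_++ rest) (List.map-++ label cs ds)) (List.++-assoc (map label cs) _ rest)

mutual
  toTree-wellLabelled : ∀ ℓ n → WellLabelled (toTree ℓ n)
  toTree-wellLabelled ℓ (node a b c) =
    tree (subst (λ xs → Linked ℤ._≤_ (lower ℓ ∷ xs)) (sym labels)
           (label-chain a ℤ.≤-refl
             (label-chain b (ℤ.<⇒≤ (lower<ℓ ℓ))
               (label-chain c (ℤ.<⇒≤ (ℓ<upper ℓ)) (ℤ.≤-refl ∷ [-])))))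
         (All.++⁺ (toTrees-wellLabelled (lower ℓ) a)
           (All.++⁺ (toTrees-wellLabelled ℓ b) (toTrees-wellLabelled (upper ℓ) c)))
    where
    below level above : List Tree
    below = toTrees (lower ℓ) a
    level = toTrees ℓ b
    above = toTrees (upper ℓ) c
    labels : map label (below ++ level ++ above) ++ [ upper ℓ ]
             ≡ map label below ++ (map label level ++ (map label above ++ [ upper ℓ ]))
    labels = trans (map-label-++ below (level ++ above) _) (cong (map label below ++_) (map-label-++ level above _))

  toTrees-wellLabelled : ∀ x ns → All WellLabelled (toTrees x ns)
  toTrees-wellLabelled x []       = []
  toTrees-wellLabelled x (n ∷ ns) = toTree-wellLabelled x n ∷ toTrees-wellLabelled x ns

WellLabelled-At : ∀ {t v s} → WellLabelled t → At t v s → WellLabelled s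
WellLabelled-At w           here       = w
WellLabelled-At (tree _ ws) (down n a) = WellLabelled-At (All.lookup ws (Nth⇒∈ n)) a

-- Encoding sequences as forests

[]≢++[_] : ∀ (u : Word) i → u ++ [ i ] ≢ []
[]≢++[_] []      i ()
[]≢++[_] (_ ∷ _) i ()

IsChildCount-unique : ∀ {L u c c′} → IsChildCount L u c → IsChildCount L u c′ → c ≡ c′
IsChildCount-unique h h′ = ℕ.≤-antisym (bound h h′) (bound h′ h)
  where
  bound : ∀ {L u c c′} → IsChildCount L u c → IsChildCount L u c′ → c ≤ c′
  bound {c = zero}  h h′ = z≤n
  bound {c = suc c} h h′ =
    Equivalence.to (h′ (suc c) (s≤s z≤n)) (Equivalence.from (h (suc c) (s≤s z≤n)) ℕ.≤-refl)

module EncodedForest (R : List Tree) where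

  L : LForest
  L = encodeForest R

  F : Tree
  F = tree (ℤ.+ 0) R

  L-sorted : AllPairs _≺_ L
  L-sorted = encodeChildren-sorted [] 0 R

  dom⁻ : ∀ {w} → w ∈F L → ∃ λ s → At F w s × w ≢ []
  dom⁻ w∈ with ∈-map⁻ proj₁ w∈
  ... | _ , x∈ , refl with ∈-encodeForest⁻ R x∈
  ...   | _ , s , a , w≢[] , refl = s , a , w≢[]

  dom⁺ : ∀ {w s} → At F w s → w ≢ [] → w ∈F L
  dom⁺ a w≢[] = ∈-map⁺ proj₁ (∈-encodeForest⁺ R a w≢[])

  lab-At : ∀ {w s} → At F w s → w ≢ [] → lab L w ≡ label s
  lab-At a w≢[] = lab-∈ L L-sorted (∈-encodeForest⁺ R a w≢[])

  childCount-At : ∀ {u z cs} → At F u (tree z cs) → u ≢ [] → IsChildCount L u (length cs)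
  childCount-At {u} {cs = cs} a u≢[] i 1≤i = mk⇔ child⇒≤ (≤⇒child i 1≤i)
    where
    child⇒≤ : (u ++ [ i ]) ∈F L → i ≤ length cs
    child⇒≤ ui∈ with dom⁻ ui∈
    ... | _ , b , _ with At-++⁻ u b
    ...   | _ , b₁ , b₂ with At-functional a b₁
    ...     | refl with b₂
    ...       | down n here = Nth⇒< n
    ≤⇒child : ∀ i → 1 ≤ i → i ≤ length cs → (u ++ [ i ]) ∈F L
    ≤⇒child (suc j) _ i≤ with <⇒Nth cs i≤
    ... | _ , n = dom⁺ (At-++⁺ a (down n here)) ([]≢++[ u ] (suc j))

  labels-At : ∀ {u z cs} → At F u (tree z cs) → u ≢ [] →
              map (λ i → lab L (u ++ [ i ])) (oneTo (length cs)) ≡ map label cs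
  labels-At {u} {cs = cs} a u≢[] = begin
    map (λ i → lab L (u ++ [ i ])) (oneTo (length cs))
      ≡⟨ map-oneTo (λ i → lab L (u ++ [ i ])) (length cs) ⟩
    tabulate {n = length cs} (λ i → lab L (u ++ [ suc (toℕ i) ]))
      ≡⟨ List.tabulate-cong (λ i → lab-At (At-++⁺ a (down (Nth-lookup cs i) here)) ([]≢++[ u ] _)) ⟩
    tabulate (label ∘ lookup cs)
      ≡⟨ List.map-tabulate (lookup cs) label ⟨
    map label (tabulate (lookup cs))
      ≡⟨ cong (map label) (List.tabulate-lookup cs) ⟩
    map label cs ∎
    where open ≡-Reasoning

  L-sorted-dom : Linked _<w_ (dom L)
  L-sorted-dom = Linked.AllPairs⇒Linked (AllPairs.map⁺ L-sorted)

rootTree : List Node → Tree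
rootTree g = tree (ℤ.+ 0) (toTrees -[1+ 0 ] g)

forestOf : List (List Node) → List Tree
forestOf s = map rootTree s ++ [ tree (ℤ.+ 0) [] ]

encodeSequence : List (List Node) → LForest
encodeSequence s = encodeForest (forestOf s)

mutual
  vertices-toTree : ∀ x n → vertices (toTree x n) ≡ size n
  vertices-toTree x (node a b c) = cong suc (begin
    vertices* (toTrees (lower x) a ++ toTrees x b ++ toTrees (upper x) c)
      ≡⟨ vertices*-++ (toTrees (lower x) a) _ ⟩
    vertices* (toTrees (lower x) a) + vertices* (toTrees x b ++ toTrees (upper x) c)
      ≡⟨ cong (vertices* (toTrees (lower x) a) +_) (vertices*-++ (toTrees x b) _) ⟩
    vertices* (toTrees (lower x) a) + (vertices* (toTrees x b) + vertices* (toTrees (upper x) c))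
      ≡⟨ cong₂ _+_ (vertices*-toTrees (lower x) a)
                   (cong₂ _+_ (vertices*-toTrees x b) (vertices*-toTrees (upper x) c)) ⟩
    sizes a + (sizes b + sizes c)
      ≡⟨ ℕ.+-assoc (sizes a) (sizes b) (sizes c) ⟨
    sizes a + sizes b + sizes c ∎)
    where open ≡-Reasoning

  vertices*-toTrees : ∀ x ns → vertices* (toTrees x ns) ≡ sizes ns
  vertices*-toTrees x []       = refl
  vertices*-toTrees x (n ∷ ns) = cong₂ _+_ (vertices-toTree x n) (vertices*-toTrees x ns)

vertices*-forestOf : ∀ s → vertices* (forestOf s) ≡ weight s + length s + 1
vertices*-forestOf s = trans (vertices*-++ (map rootTree s) _) (cong (_+ 1) (roots s))
  where
  roots : ∀ s → vertices* (map rootTree s) ≡ weight s + length s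
  roots []      = refl
  roots (g ∷ s) = begin
    suc (vertices* (toTrees -[1+ 0 ] g)) + vertices* (map rootTree s)
      ≡⟨ cong₂ (λ x y → suc x + y) (vertices*-toTrees _ g) (roots s) ⟩
    suc (sizes g) + (weight s + length s)
      ≡⟨ cong suc (ℕ.+-assoc (sizes g) _ _) ⟨
    suc (sizes g + weight s + length s)
      ≡⟨ ℕ.+-suc _ (length s) ⟨
    sizes g + weight s + suc (length s) ∎
    where open ≡-Reasoning

length-encodeSequence : ∀ s → length (encodeSequence s) ≡ weight s + length s + 1
length-encodeSequence s = trans (length-encodeChildren [] 0 (forestOf s)) (vertices*-forestOf s)

module EncodedSequence (s : List (List Node)) where
  open EncodedForest (forestOf s)

  private
    length-forestOf : length (forestOf s) ≡ length s + 1
    length-forestOf = trans (List.length-++ (map rootTree s)) (cong (_+ 1) (List.length-map rootTree s))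

    roots-labelled : All (λ c → label c ≡ ℤ.+ 0) (forestOf s)
    roots-labelled = All.++⁺ (All.map⁺ (All.universal (λ _ → refl) s)) (refl ∷ [])

    toTrees-labelled : ∀ x ns → All (λ d → WellLabelled d × label d ≡ x) (toTrees x ns)
    toTrees-labelled x []       = []
    toTrees-labelled x (n ∷ ns) = (toTree-wellLabelled x n , refl) ∷ toTrees-labelled x ns

    grandchildren : All (All (λ d → WellLabelled d × label d ≡ -[1+ 0 ]) ∘ subtrees) (forestOf s)
    grandchildren = All.++⁺ (All.map⁺ (All.universal (toTrees-labelled -[1+ 0 ]) s)) ([] ∷ [])

    last-root : ∀ {s c} → Nth (forestOf s) (length s) c → c ≡ tree (ℤ.+ 0) []
    last-root {[]}    zero    = refl
    last-root {_ ∷ s} (suc n) = last-root {s} n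

    roots⇒ : ∀ i → [ i ] ∈F L → 1 ≤ i × i ≤ length s + 1
    roots⇒ i i∈ with dom⁻ i∈
    ... | _ , down n here , _ = s≤s z≤n , subst (i ≤_) length-forestOf (Nth⇒< n)

    ⇒roots : ∀ i → 1 ≤ i × i ≤ length s + 1 → [ i ] ∈F L
    ⇒roots (suc j) (_ , i≤) with <⇒Nth (forestOf s) (subst (suc j ≤_) (sym length-forestOf) i≤)
    ... | _ , n = dom⁺ (down n here) (λ ())

    parent-closed : ∀ u i → (u ++ [ i ]) ∈F L → u ≢ [] → u ∈F L
    parent-closed u i ui∈ u≢[] with dom⁻ ui∈
    ... | _ , a , _ with At-++⁻ u a
    ...   | _ , a₁ , _ = dom⁺ a₁ u≢[]

    child-counts : ∀ u → u ∈F L → ∃ λ c → IsChildCount L u c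
    child-counts u u∈ with dom⁻ u∈
    ... | tree _ cs , a , u≢[] = length cs , childCount-At a u≢[]

    last-root-leaf : ∀ i → 1 ≤ i → ¬ (suc (length s) ∷ [ i ]) ∈F L
    last-root-leaf i _ w∈ with dom⁻ w∈
    ... | _ , down n a , _ with last-root n
    ...   | refl with a
    ...     | down () _

    root-labels : ∀ u → u ∈F L → length u ≡ 1 → lab L u ≡ ℤ.+ 0
    root-labels (i ∷ []) u∈ _ with dom⁻ u∈
    ... | _ , a@(down n here) , u≢[] = trans (lab-At a u≢[]) (All.lookup roots-labelled (Nth⇒∈ n))

    depth-two-labels : ∀ u → u ∈F L → length u ≡ 2 → lab L u ≡ -[1+ 0 ]
    depth-two-labels (i ∷ k ∷ []) u∈ _ with dom⁻ u∈
    ... | _ , a@(down n (down n′ here)) , u≢[] =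
      trans (lab-At a u≢[]) (proj₂ (All.lookup (All.lookup grandchildren (Nth⇒∈ n)) (Nth⇒∈ n′)))

    deep-labels : ∀ u → u ∈F L → 2 ≤ length u → ∀ c → IsChildCount L u c → 1 ≤ c →
                  Linked ℤ._≤_ (lower (lab L u) ∷ (map (λ i → lab L (u ++ [ i ])) (oneTo c) ++ [ upper (lab L u) ]))
    deep-labels []          _  ()        _ _   _
    deep-labels (_ ∷ [])    _  (s≤s ())  _ _   _
    deep-labels u@(_ ∷ _ ∷ _) u∈ _ c isc _ with dom⁻ u∈
    ... | _ , a@(down n (down n′ a′)) , u≢[]
        with WellLabelled-At (proj₁ (All.lookup (All.lookup grandchildren (Nth⇒∈ n)) (Nth⇒∈ n′))) a′
    ...   | tree chain _
          rewrite IsChildCount-unique {u = u} isc (childCount-At a u≢[]) | lab-At a u≢[] | labels-At a u≢[]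
          = chain

  wellLabeled : WellLabeledForest (weight s) (length s) (encodeSequence s)
  wellLabeled = record
    { sorted   = L-sorted-dom
    ; words    = All.tabulate λ w∈ → let (_ , a , w≢[]) = dom⁻ w∈ in w≢[] , At-positive a
    ; roots    = λ i → mk⇔ (roots⇒ i) (⇒roots i)
    ; parent   = parent-closed
    ; children = child-counts
    ; lastRoot = last-root-leaf
    ; size     = length-encodeSequence s
    ; labRoot  = root-labels
    ; labTwo   = depth-two-labels
    ; labChild = deep-labels
    }

encodeSequence-wellLabeled : ∀ {r t} s → Shape r t s → WellLabeledForest r t (encodeSequence s)
encodeSequence-wellLabeled s (refl , refl) = EncodedSequence.wellLabeled s

encodeSequence-injective : ∀ {s s′} → encodeSequence s ≡ encodeSequence s′ → s ≡ s′
encodeSequence-injective {s} {s′} eq =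
  List.map-injective rootTree-injective (List.++-cancelʳ _ (map rootTree s) (map rootTree s′) (encodeForest-injective eq))
  where
  rootTree-injective : ∀ {g g′} → rootTree g ≡ rootTree g′ → g ≡ g′
  rootTree-injective eq = toTrees-injective -[1+ 0 ] (cong subtrees eq)

-- Decoding forests

totalLength : LForest → ℕ
totalLength []      = 0
totalLength (x ∷ L) = length (proj₁ x) + totalLength L

∈F⇒≤totalLength : ∀ L {w} → w ∈F L → length w ≤ totalLength L
∈F⇒≤totalLength (x ∷ L) (here refl) = ℕ.m≤m+n _ _
∈F⇒≤totalLength (x ∷ L) (there w∈)  = ℕ.≤-trans (∈F⇒≤totalLength L w∈) (ℕ.m≤n+m _ _)

module Decoding {ρ τ L} (W : WellLabeledForest ρ τ L) where
  open WellLabeledForest W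

  L-sorted : AllPairs _≺_ L
  L-sorted = AllPairs.map⁻ (Linked.Linked⇒AllPairs <w-trans sorted)

  prefix-closed : ∀ v u → (u ++ v) ∈F L → u ≢ [] → u ∈F L
  prefix-closed []      u uv∈ _    = subst (_∈F L) (List.++-identityʳ u) uv∈
  prefix-closed (k ∷ v) u uv∈ u≢[] =
    parent u k (prefix-closed v (u ++ [ k ]) (subst (_∈F L) (sym (List.++-assoc u [ k ] v)) uv∈) ([]≢++[ u ] k)) u≢[]

  childCount : ∀ {u} → u ∈F L → ℕ
  childCount {u} u∈ = proj₁ (children u u∈)

  child∈ : ∀ {u} (u∈ : u ∈F L) {i} → 1 ≤ i → i ≤ childCount u∈ → (u ++ [ i ]) ∈F L
  child∈ {u} u∈ {i} 1≤i = Equivalence.from (proj₂ (children u u∈) i 1≤i)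

  ∈⇒≤childCount : ∀ {u} (u∈ : u ∈F L) {i} → 1 ≤ i → (u ++ [ i ]) ∈F L → i ≤ childCount u∈
  ∈⇒≤childCount {u} u∈ {i} 1≤i = Equivalence.to (proj₂ (children u u∈) i 1≤i)

  mutual
    decodeTree : ℕ → (u : Word) → u ∈F L → Tree
    decodeTree n u u∈ = tree (lab L u) (decodeChildren n u u∈)

    decodeChildren : ℕ → (u : Word) → u ∈F L → List Tree
    decodeChildren zero    u u∈ = []
    decodeChildren (suc n) u u∈ =
      tabulate λ i → decodeTree n (u ++ [ suc (toℕ i) ]) (child∈ u∈ (s≤s z≤n) (Fin.toℕ<n i))

  At-decodeTree⁻ : ∀ n u u∈ {v s} → At (decodeTree n u u∈) v s → (u ++ v) ∈F L × label s ≡ lab L (u ++ v)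
  At-decodeTree⁻ n u u∈ here =
    subst (_∈F L) (sym (List.++-identityʳ u)) u∈ , cong (lab L) (sym (List.++-identityʳ u))
  At-decodeTree⁻ zero    u u∈ (down () _)
  At-decodeTree⁻ (suc n) u u∈ (down {v = v} nth a) with Nth-tabulate⁻ _ nth
  ... | i , refl , refl with At-decodeTree⁻ n (u ++ [ suc (toℕ i) ]) _ a
  ...   | w∈ , e = subst (_∈F L) assoc w∈ , trans e (cong (lab L) assoc)
    where
    assoc : (u ++ [ suc (toℕ i) ]) ++ v ≡ u ++ (suc (toℕ i) ∷ v)
    assoc = List.++-assoc u [ suc (toℕ i) ] v

  private
    split-last : ∀ (u : Word) k v → (u ++ (k ∷ v)) ∈F L → ((u ++ [ k ]) ++ v) ∈F L
    split-last u k v = subst (_∈F L) (sym (List.++-assoc u [ k ] v))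

    bound-step : ∀ n (u : Word) (k : ℕ) → (∀ {w} → w ∈F L → length w ≤ suc n + length u) →
                 ∀ {w} → w ∈F L → length w ≤ n + length (u ++ [ k ])
    bound-step n u k bound {w} w∈ = subst (length w ≤_) eq (bound w∈)
      where
      eq : suc n + length u ≡ n + length (u ++ [ k ])
      eq = trans (sym (ℕ.+-suc n (length u)))
                 (cong (n +_) (trans (ℕ.+-comm 1 (length u)) (sym (List.length-++ u))))

  At-decodeTree⁺ : ∀ n u u∈ → (∀ {w} → w ∈F L → length w ≤ n + length u) →
                   ∀ v → (u ++ v) ∈F L → ∃ (At (decodeTree n u u∈) v)
  At-decodeTree⁺ n u u∈ bound [] _ = _ , here
  At-decodeTree⁺ n u u∈ bound (k ∷ v) uv∈ with All.++⁻ʳ u (proj₂ (All.lookup words uv∈))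
  At-decodeTree⁺ n u u∈ bound (zero ∷ v) uv∈ | () ∷ _
  At-decodeTree⁺ zero u u∈ bound (suc j ∷ v) uv∈ | _ =
    ⊥-elim (ℕ.m+1+n≰m (length u) (subst (_≤ length u) (List.length-++ u) (bound uv∈)))
  At-decodeTree⁺ (suc n) u u∈ bound (suc j ∷ v) uv∈ | _
    with j< ← ∈⇒≤childCount u∈ (s≤s z≤n)
                (prefix-closed v (u ++ [ suc j ]) (split-last u (suc j) v uv∈) ([]≢++[ u ] (suc j)))
    with fromℕ< j< | Fin.toℕ-fromℕ< j<
  ... | i | refl
    with At-decodeTree⁺ n (u ++ [ suc (toℕ i) ]) _ (bound-step n u (suc (toℕ i)) bound) v
                        (split-last u (suc (toℕ i)) v uv∈)
  ...   | s , a = s , down (Nth-tabulate⁺ _ i) a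

  decodeChildren-depth-two : ∀ n k (k∈ : [ k ] ∈F L) →
                             All (λ c → label c ≡ -[1+ 0 ]) (decodeChildren n [ k ] k∈)
  decodeChildren-depth-two zero    k k∈ = []
  decodeChildren-depth-two (suc n) k k∈ =
    All.tabulate⁺ λ i → labTwo _ (child∈ k∈ (s≤s z≤n) (Fin.toℕ<n i)) refl

  private
    children-chain : ∀ {u} (u∈ : u ∈F L) → 2 ≤ length u → ∀ c → IsChildCount L u c →
      Linked ℤ._≤_ (lower (lab L u) ∷ (map (λ i → lab L (u ++ [ i ])) (oneTo c) ++ [ upper (lab L u) ]))
    children-chain {u} u∈ _   zero    _   = ℤ.<⇒≤ (lower<upper (lab L u)) ∷ [-]
    children-chain u∈ 2≤u (suc c) isc = labChild _ u∈ 2≤u (suc c) isc (s≤s z≤n)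

  decodeTree-wellLabelled : ∀ n u u∈ → 2 ≤ length u → WellLabelled (decodeTree n u u∈)
  decodeTree-wellLabelled zero    u u∈ _   = tree (ℤ.<⇒≤ (lower<upper (lab L u)) ∷ [-]) []
  decodeTree-wellLabelled (suc n) u u∈ 2≤u =
    tree (subst (λ xs → Linked ℤ._≤_ (lower (lab L u) ∷ (xs ++ [ upper (lab L u) ]))) labels
               (children-chain u∈ 2≤u (childCount u∈) (proj₂ (children u u∈))))
         (All.tabulate⁺ λ i → decodeTree-wellLabelled n _ _ (ℕ.≤-trans 2≤u (List.length-++-≤ˡ u)))
    where
    labels : map (λ i → lab L (u ++ [ i ])) (oneTo (childCount u∈)) ≡ map label (decodeChildren (suc n) u u∈)
    labels = trans (map-oneTo _ (childCount u∈)) (sym (List.map-tabulate _ label))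

  root∈ : (i : Fin (suc τ)) → [ suc (toℕ i) ] ∈F L
  root∈ i = Equivalence.from (roots (suc (toℕ i)))
                             (s≤s z≤n , subst (suc (toℕ i) ≤_) (ℕ.+-comm 1 τ) (Fin.toℕ<n i))

  -- Every word has length at most totalLength L, so this fuel decodes each root completely.
  decodeRoot : Fin (suc τ) → Tree
  decodeRoot i = decodeTree (totalLength L) [ suc (toℕ i) ] (root∈ i)

  module Decoded = EncodedForest (tabulate decodeRoot)

  At-decoded⁻ : ∀ {w s} → At Decoded.F w s → w ≢ [] → w ∈F L × label s ≡ lab L w
  At-decoded⁻ here       w≢[] = ⊥-elim (w≢[] refl)
  At-decoded⁻ (down n a) _    with Nth-tabulate⁻ decodeRoot n
  ... | i , refl , refl = At-decodeTree⁻ (totalLength L) [ suc (toℕ i) ] (root∈ i) a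

  At-decoded⁺ : ∀ {w} → w ∈F L → ∃ (At Decoded.F w)
  At-decoded⁺ {[]}    w∈ = ⊥-elim (proj₁ (All.lookup words w∈) refl)
  At-decoded⁺ {k ∷ v} w∈ with Equivalence.to (roots k) (prefix-closed v [ k ] w∈ (λ ()))
  ... | s≤s z≤n , k≤
    with k< ← subst (k ≤_) (ℕ.+-comm τ 1) k≤
    with fromℕ< k< | Fin.toℕ-fromℕ< k<
  ...   | i | refl
    with At-decodeTree⁺ (totalLength L) [ k ] (root∈ i)
                        (λ w∈ → ℕ.≤-trans (∈F⇒≤totalLength L w∈) (ℕ.m≤m+n _ 1)) v w∈
  ...     | s , a = s , down (Nth-tabulate⁺ decodeRoot i) a

  L≡decoded : L ≡ Decoded.L
  L≡decoded = sorted-≡ <w-irrefl <w-trans L-sorted Decoded.L-sorted ⊆ ⊇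
    where
    ⊆ : ∀ {x} → x ∈ L → x ∈ Decoded.L
    ⊆ {w , z} x∈ =
      let w∈ = ∈-map⁺ proj₁ x∈
          w≢[] = proj₁ (All.lookup words w∈)
          (s , a) = At-decoded⁺ w∈
      in subst (λ z → (w , z) ∈ Decoded.L) (trans (proj₂ (At-decoded⁻ a w≢[])) (lab-∈ L L-sorted x∈))
               (∈-encodeForest⁺ _ a w≢[])
    ⊇ : ∀ {x} → x ∈ Decoded.L → x ∈ L
    ⊇ x∈ with ∈-encodeForest⁻ _ x∈
    ... | w , s , a , w≢[] , refl with At-decoded⁻ a w≢[]
    ...   | w∈ , e with ∈-map⁻ proj₁ w∈
    ...     | (_ , z) , y∈ , refl = subst (λ z → (w , z) ∈ L) (sym (trans e (lab-∈ L L-sorted y∈))) y∈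

  decodeChildren-wellLabelled : ∀ n k (k∈ : [ k ] ∈F L) → All WellLabelled (decodeChildren n [ k ] k∈)
  decodeChildren-wellLabelled zero    k k∈ = []
  decodeChildren-wellLabelled (suc n) k k∈ = All.tabulate⁺ λ i → decodeTree-wellLabelled n _ _ (s≤s (s≤s z≤n))

  decodeChildren-last : ∀ n k (k∈ : [ k ] ∈F L) → k ≡ suc τ → decodeChildren n [ k ] k∈ ≡ []
  decodeChildren-last zero    k k∈ _    = refl
  decodeChildren-last (suc n) k k∈ refl = tabulate-[] _ (no-children (childCount k∈) (child∈ k∈ (s≤s z≤n)))
    where
    no-children : ∀ c → (1 ≤ c → ([ suc τ ] ++ [ 1 ]) ∈F L) → c ≡ 0
    no-children zero    _     = refl
    no-children (suc c) child = ⊥-elim (lastRoot 1 (s≤s z≤n) (child (s≤s z≤n)))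

  decodedSequence : List (List Node)
  decodedSequence = tabulate λ i → fromTrees (subtrees (decodeRoot (inject₁ i)))

  rootTree-decodeRoot : ∀ i → rootTree (fromTrees (subtrees (decodeRoot i))) ≡ decodeRoot i
  rootTree-decodeRoot i =
    cong₂ tree (sym (labRoot _ (root∈ i) refl))
               (toTrees-fromTrees -[1+ 0 ] _ (decodeChildren-depth-two (totalLength L) _ (root∈ i))
                                             (decodeChildren-wellLabelled (totalLength L) _ (root∈ i)))

  decodeRoot-last : decodeRoot (fromℕ τ) ≡ tree (ℤ.+ 0) []
  decodeRoot-last =
    cong₂ tree (labRoot _ (root∈ (fromℕ τ)) refl)
               (decodeChildren-last (totalLength L) _ (root∈ (fromℕ τ)) (cong suc (Fin.toℕ-fromℕ τ)))

  decoded≡forestOf : tabulate decodeRoot ≡ forestOf decodedSequence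
  decoded≡forestOf = begin
    tabulate decodeRoot
      ≡⟨ tabulate-∷ʳ decodeRoot ⟩
    tabulate (decodeRoot ∘ inject₁) ++ [ decodeRoot (fromℕ τ) ]
      ≡⟨ cong₂ _++_ first-roots (cong [_] decodeRoot-last) ⟩
    map rootTree decodedSequence ++ [ tree (ℤ.+ 0) [] ] ∎
    where
    open ≡-Reasoning
    first-roots : tabulate (decodeRoot ∘ inject₁) ≡ map rootTree decodedSequence
    first-roots = sym (trans (List.map-tabulate _ rootTree) (List.tabulate-cong (rootTree-decodeRoot ∘ inject₁)))

  decode : ∃ λ s → Shape ρ τ s × L ≡ encodeSequence s
  decode = decodedSequence , (weight≡ρ , length≡τ) , L≡
    where
    open ≡-Reasoning
    L≡ : L ≡ encodeSequence decodedSequence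
    L≡ = trans L≡decoded (cong encodeForest decoded≡forestOf)
    length≡τ : length decodedSequence ≡ τ
    length≡τ = List.length-tabulate _
    weight≡ρ : weight decodedSequence ≡ ρ
    weight≡ρ = ℕ.+-cancelʳ-≡ τ _ _ (ℕ.+-cancelʳ-≡ 1 _ _ (begin
      weight decodedSequence + τ + 1
        ≡⟨ cong (λ t → weight decodedSequence + t + 1) length≡τ ⟨
      weight decodedSequence + length decodedSequence + 1
        ≡⟨ length-encodeSequence decodedSequence ⟨
      length (encodeSequence decodedSequence)
        ≡⟨ cong length L≡ ⟨
      length L
        ≡⟨ WellLabeledForest.size W ⟩
      ρ + τ + 1 ∎))

lemma12 : (ρ τ : ℕ) → 1 ≤ τ →
    Σ (List LForest) (λ E → Enumerates (WellLabeledForest ρ τ) E ×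
      ((4 * ρ + τ) * length E ≡ τ * ((4 * ρ + τ) C ρ)))
lemma12 ρ τ _ =
  map encodeSequence (sequences ρ τ) ,
  Enumerates-map encodeSequence-injective encodeSequence-wellLabeled (Decoding.decode) (sequences-enumerates ρ τ) ,
  (begin
    (4 * ρ + τ) * length (map encodeSequence (sequences ρ τ))
      ≡⟨ cong ((4 * ρ + τ) *_) (List.length-map _ (sequences ρ τ)) ⟩
    (4 * ρ + τ) * length (sequences ρ τ)
      ≡⟨ cong ((4 * ρ + τ) *_) (length-sequences ρ τ) ⟩
    (4 * ρ + τ) * count 4 ρ τ
      ≡⟨ count-closed-form 4 ρ τ ⟩
    τ * ((4 * ρ + τ) C ρ) ∎)
  where open ≡-Reasoning
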